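{- Let $n>4$ and let $P$ be a pot such that $C_{min}(P)=\{W_n\}$. Then in any realization of $W_n$ by $P$, no bond-edge type is used both on an edge $e$ of the outer cycle and on a spoke that is not incident to $e$.
   Context: The wheel graph $W_n$ consists of a cycle on $n-1$ vertices (the outer cycle) together with one additional vertex (the hub) adjacent to every vertex of the cycle; the edges from the hub are called spokes. A tile is a vertex together with a finite multiset of half-edges, each half-edge labeled by a cohesive-end symbol $a$ or its complement $\hat a$, where $a$ ranges over an alphabet of bond-edge types. A pot $P$ is a finite set of distinct tile types. A graph $G$ (loops and multiple edges allowed) is realized by $P$ if each vertex of $G$ can be assigned a copy of some tile type in $P$ (any number of copies of each type may be used) so that the half-edges at each vertex are in bijection with the edge-ends at that vertex and every edge of $G$ is formed by joining a half-edge labeled $a$ with a half-edge labeled $\hat a$ for some bond-edge type $a$ (the edge is then said to use bond-edge type $a$), with no half-edge left unmatched. $C_{min}(P)$ is the set of graphs of minimum order among all graphs realized by $P$; the hypothesis $C_{min}(P)=\{W_n\}$ means (up to isomorphism) $W_n$ is the unique graph of minimum order realized by $P$. -}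

module Defs where

open import Data.Nat as ℕ using (ℕ; zero; suc; _≤_; _<_; pred)
open import Data.Bool using (Bool; true; false; not; if_then_else_)
open import Data.Fin as Fin using (Fin; zero; suc; toℕ; fromℕ<; _↑ˡ_; _↑ʳ_; splitAt)
open import Data.Fin.Properties using () renaming (_≟_ to _≟ᶠ_)
open import Data.List using (List; []; _∷_; [_]; _++_; concatMap; allFin)
open import Data.List.Membership.Propositional using (_∈_)
open import Data.List.Relation.Unary.AllPairs using (AllPairs)
open import Data.List.Relation.Binary.Permutation.Propositional using (_↭_)
open import Data.Product using (_×_; _,_; proj₁; proj₂; ∃₂)
open import Data.Sum using (_⊎_; inj₁; inj₂)
open import Function.Bundles using (_↔_; Inverse)
open import Relation.Nullary using (¬_; does; yes; no)
open import Relation.Binary.PropositionalEquality using (_≡_)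

-- Finite graphs, loops and multiple edges allowed.
-- Vertices Fin order, edges Fin size; each edge has two ends,
-- end false at proj₁ (ends e), end true at proj₂ (ends e).

record Graph : Set where
  field
    order : ℕ
    size  : ℕ
    ends  : Fin size → Fin order × Fin order

open Graph public

Vertex : Graph → Set
Vertex G = Fin (order G)

Edge : Graph → Set
Edge G = Fin (size G)

endpoint : (G : Graph) → Edge G → Bool → Vertex G
endpoint G e false = proj₁ (ends G e)
endpoint G e true  = proj₂ (ends G e)

Incident : (G : Graph) → Edge G → Edge G → Set
Incident G e f = ∃₂ λ b b′ → endpoint G e b ≡ endpoint G f b′

SameEnds : ∀ {A : Set} → A × A → A × A → Set
SameEnds (a , b) (c , d) = (a ≡ c × b ≡ d) ⊎ (a ≡ d × b ≡ c)

record _≅_ (G H : Graph) : Set where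
  field
    vmap : Vertex G ↔ Vertex H
    emap : Edge G ↔ Edge H
    pres : ∀ e → SameEnds (ends H (Inverse.to emap e))
                          (Inverse.to vmap (proj₁ (ends G e)) , Inverse.to vmap (proj₂ (ends G e)))

-- Wheels.  Wheel k : hub = zero, cycle vertices suc i (i : Fin k),
-- edges Fin (k + k): i ↑ˡ k is the cycle edge {i, i+1 mod k},
-- k ↑ʳ j is the spoke {hub, j}.

next : ∀ {k} → Fin k → Fin k
next {suc j} i with toℕ i ℕ.<? j
... | yes p = fromℕ< (ℕ.s≤s p)
... | no _  = zero

Wheel : ℕ → Graph
Wheel k = record { order = suc k ; size = k ℕ.+ k ; ends = ends′ }
  where
  ends′ : Fin (k ℕ.+ k) → Fin (suc k) × Fin (suc k)
  ends′ e with splitAt k e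
  ... | inj₁ i = suc i , suc (next i)
  ... | inj₂ j = zero , suc j

-- W n : the wheel of order n (outer cycle on n - 1 vertices); W 0 is the empty graph.
W : ℕ → Graph
W zero    = record { order = 0 ; size = 0 ; ends = λ () }
W (suc k) = Wheel k

cycleEdge : ∀ n → Fin (pred n) → Edge (W n)
cycleEdge (suc k) i = i ↑ˡ k

spoke : ∀ n → Fin (pred n) → Edge (W n)
spoke (suc k) j = k ↑ʳ j

-- Tiles and pots.  Bond-edge types are natural numbers; a label is a
-- bond-edge type together with a flag (true = complemented, â).

record Label : Set where
  constructor lab
  field
    type  : ℕ
    hat   : Bool

-- a tile type is a finite multiset of half-edge labels (list up to ↭)
Tile : Set
Tile = List Label

record Pot : Set where
  field
    tiles    : List Tile
    distinct : AllPairs (λ s t → ¬ (s ↭ t)) tiles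

open Pot public

-- Realizations.  Each edge e uses bond-edge type (bond e); the end
-- (hatEnd e) carries â and the other end carries a.

endLabel : (G : Graph) → (Edge G → ℕ) → (Edge G → Bool) → Edge G → Bool → Label
endLabel G bond hatEnd e b = lab (bond e) (if b then hatEnd e else not (hatEnd e))

labelsAt : (G : Graph) → (Edge G → ℕ) → (Edge G → Bool) → Vertex G → List Label
labelsAt G bond hatEnd v = concatMap (λ e → at e false ++ at e true) (allFin (size G))
  where
  at : Edge G → Bool → List Label
  at e b = if does (endpoint G e b ≟ᶠ v) then [ endLabel G bond hatEnd e b ] else []

record Realization (P : Pot) (G : Graph) : Set where
  field
    tile   : Vertex G → Tile
    tileIn : ∀ v → tile v ∈ tiles P
    bond   : Edge G → ℕ
    hatEnd : Edge G → Bool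
    match  : ∀ v → labelsAt G bond hatEnd v ↭ tile v

open Realization public

Realizes : Pot → Graph → Set
Realizes P G = Realization P G

InCmin : Pot → Graph → Set
InCmin P G = 0 < order G × Realizes P G
           × (∀ H → 0 < order H → Realizes P H → order G ≤ order H)

CminIs : Pot → Graph → Set
CminIs P G = InCmin P G × (∀ H → InCmin P H → H ≅ G)

{-# OPTIONS --safe #-}
-- Suppose a cycle edge {i, i+1} and a spoke {hub, j} with j ∉ {i, i+1} use the same bond-edge
-- type. One end of the spoke carries the same label as the end i+1 of the cycle edge; exchanging
-- these two ends leaves the multiset of labels at every vertex unchanged, so the same tiles realize
-- the rewired graph. It has the order of W n, hence is isomorphic to W n, yet it has a pair of
-- parallel edges joining the hub to i+1 or to i, whereas a wheel with at least three rim vertices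
-- is simple.
module Submission where

open import Defs
open import Data.Nat using (ℕ; _<_; pred)
open import Data.Fin using (Fin)
open import Relation.Nullary using (¬_)
open import Relation.Binary.PropositionalEquality using (_≢_)

open import Algebra.Definitions using (Involutive)
open import Data.Bool using (Bool; true; false; if_then_else_)
import Data.Bool.Properties as Bool
open import Data.Empty using (⊥-elim)
open import Data.Fin using (zero; suc; toℕ; _↑ˡ_; _↑ʳ_; splitAt)
open import Data.Fin.Properties
  using (splitAt-↑ˡ; splitAt-↑ʳ; splitAt⁻¹-↑ˡ; splitAt⁻¹-↑ʳ; suc-injective; ↑ʳ-injective; toℕ-fromℕ<)
  renaming (_≟_ to _≟ᶠ_)
open import Data.List using (List; []; _∷_; [_]; _++_; map; concatMap; allFin; cartesianProduct)
open import Data.List.Membership.Propositional using (_∈_)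
open import Data.List.Membership.Propositional.Properties using (∈-map⁺; ∈-allFin; ∈-cartesianProduct⁺)
open import Data.List.Membership.Propositional.Properties.WithK using (unique∧set⇒bag)
open import Data.List.Properties using (++-assoc; concatMap-cong; concatMap-map)
open import Data.List.Relation.Binary.BagAndSetEquality using (concat-cong; ↭⇒∼bag; ∼bag⇒↭)
open import Data.List.Relation.Binary.Permutation.Propositional using (_↭_; ↭-trans; module PermutationReasoning)
open import Data.List.Relation.Binary.Permutation.Propositional.Properties using (map⁺)
open import Data.List.Relation.Unary.AllPairs using ([]; _∷_)
open import Data.List.Relation.Unary.Any using (here; there)
open import Data.List.Relation.Unary.All using ([]; _∷_)
open import Data.List.Relation.Unary.Unique.Propositional using (Unique)
import Data.List.Relation.Unary.Unique.Propositional.Properties as Unique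
import Data.Nat as ℕ
open import Data.Nat.Properties using (≮⇒≥; <⇒≢; <⇒≤; ≤⇒≯; n≤1+n; m≤n⇒m≤1+n)
open import Data.Product using (_×_; _,_; proj₁; proj₂; ∃; uncurry)
open import Data.Product.Properties using (≡-dec; ,-injective)
open import Data.Sum using (_⊎_; inj₁; inj₂)
open import Function using (_∘_)
open import Function.Bundles using (Inverse; Injection; mk⇔)
open import Function.Properties.Inverse using (Inverse⇒Injection)
open import Relation.Binary.Definitions using (DecidableEquality)
open import Relation.Nullary using (does; yes; no)
open import Relation.Binary.PropositionalEquality
  using (_≡_; refl; sym; trans; cong; cong₂; subst; subst₂)

concatMap⁺ : ∀ {A B : Set} (f : A → List B) {xs ys : List A} →
             xs ↭ ys → concatMap f xs ↭ concatMap f ys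
concatMap⁺ f xs↭ys = ∼bag⇒↭ (concat-cong (↭⇒∼bag (map⁺ f xs↭ys)))

map-involutive-↭ : ∀ {A : Set} {xs : List A} → Unique xs → (∀ x → x ∈ xs) →
                   (τ : A → A) → Involutive _≡_ τ → map τ xs ↭ xs
map-involutive-↭ {xs = xs} unique complete τ τ∘τ≡id =
  ∼bag⇒↭ (unique∧set⇒bag (Unique.map⁺ injective unique) unique
    (λ {x} → mk⇔ (λ _ → complete x)
                 (λ _ → subst (_∈ map τ xs) (τ∘τ≡id x) (∈-map⁺ τ (complete (τ x))))))
  where
  injective : ∀ {x y} → τ x ≡ τ y → x ≡ y
  injective {x} {y} τx≡τy = trans (sym (τ∘τ≡id x)) (trans (cong τ τx≡τy) (τ∘τ≡id y))

concatMap-cartesianProduct-Bool :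
  ∀ {A B : Set} (f : A × Bool → List B) (xs : List A) →
  concatMap (λ x → f (x , false) ++ f (x , true)) xs
    ≡ concatMap f (cartesianProduct xs (false ∷ true ∷ []))
concatMap-cartesianProduct-Bool f []       = refl
concatMap-cartesianProduct-Bool f (x ∷ xs) =
  trans (++-assoc (f (x , false)) (f (x , true)) _)
        (cong (λ ys → f (x , false) ++ f (x , true) ++ ys) (concatMap-cartesianProduct-Bool f xs))

module _ {A : Set} (_≟_ : DecidableEquality A) where

  transpose : A → A → A → A
  transpose a b x with x ≟ a | x ≟ b
  ... | yes _ | _     = b
  ... | no _  | yes _ = a
  ... | no _  | no _  = x

  transpose-left : ∀ a b → transpose a b a ≡ b
  transpose-left a b with a ≟ a
  ... | yes _  = refl
  ... | no a≢a = ⊥-elim (a≢a refl)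

  transpose-right : ∀ a b → transpose a b b ≡ a
  transpose-right a b with b ≟ a | b ≟ b
  ... | yes b≡a | _      = b≡a
  ... | no _    | yes _  = refl
  ... | no _    | no b≢b = ⊥-elim (b≢b refl)

  transpose-fixed : ∀ {a b x} → x ≢ a → x ≢ b → transpose a b x ≡ x
  transpose-fixed {a} {b} {x} x≢a x≢b with x ≟ a | x ≟ b
  ... | yes x≡a | _       = ⊥-elim (x≢a x≡a)
  ... | no _    | yes x≡b = ⊥-elim (x≢b x≡b)
  ... | no _    | no _    = refl

  transpose-involutive : ∀ a b → Involutive _≡_ (transpose a b)
  transpose-involutive a b x with x ≟ a | x ≟ b
  ... | yes refl | _        = transpose-right a b
  ... | no _     | yes refl = transpose-left a b
  ... | no x≢a   | no x≢b   = transpose-fixed x≢a x≢b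

  transpose-preserves : ∀ {B : Set} (f : A → B) {a b} → f a ≡ f b →
                        ∀ x → f (transpose a b x) ≡ f x
  transpose-preserves f {a} {b} fa≡fb x with x ≟ a | x ≟ b
  ... | yes refl | _        = sym fa≡fb
  ... | no _     | yes refl = fa≡fb
  ... | no _     | no _     = refl

End : Graph → Set
End G = Edge G × Bool

≟-End : ∀ G → DecidableEquality (End G)
≟-End G = ≡-dec _≟ᶠ_ Bool._≟_

endpointOf : (G : Graph) → End G → Vertex G
endpointOf G = uncurry (endpoint G)

allEnds : (G : Graph) → List (End G)
allEnds G = cartesianProduct (allFin (size G)) (false ∷ true ∷ [])

allEnds-unique : ∀ G → Unique (allEnds G)
allEnds-unique G = Unique.cartesianProductWith⁺ _,_ ,-injective
  (Unique.allFin⁺ (size G)) (((λ ()) ∷ []) ∷ [] ∷ [])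

∈-allEnds : ∀ G (x : End G) → x ∈ allEnds G
∈-allEnds G (e , b) = ∈-cartesianProduct⁺ (∈-allFin e) (bool∈ b)
  where
  bool∈ : ∀ b → b ∈ false ∷ true ∷ []
  bool∈ false = here refl
  bool∈ true  = there (here refl)

rewire : (G : Graph) → (End G → End G) → Graph
rewire G τ = record
  { order = order G
  ; size  = size G
  ; ends  = λ e → endpointOf G (τ (e , false)) , endpointOf G (τ (e , true))
  }

labelIfAt : (G : Graph) → (Edge G → ℕ) → (Edge G → Bool) → Vertex G → End G → List Label
labelIfAt G bond hatEnd v x =
  if does (endpointOf G x ≟ᶠ v) then [ uncurry (endLabel G bond hatEnd) x ] else []

labelsAt-allEnds : ∀ G bond hatEnd v →
                   labelsAt G bond hatEnd v ≡ concatMap (labelIfAt G bond hatEnd v) (allEnds G)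
labelsAt-allEnds G bond hatEnd v =
  concatMap-cartesianProduct-Bool (labelIfAt G bond hatEnd v) (allFin (size G))

labelsAt-rewire : ∀ G (τ : End G → End G) bond hatEnd → Involutive _≡_ τ →
                  (∀ x → uncurry (endLabel G bond hatEnd) (τ x) ≡ uncurry (endLabel G bond hatEnd) x) →
                  ∀ v → labelsAt (rewire G τ) bond hatEnd v ↭ labelsAt G bond hatEnd v
labelsAt-rewire G τ bond hatEnd τ∘τ≡id τ-label v = begin
  labelsAt (rewire G τ) bond hatEnd v
    ≡⟨ labelsAt-allEnds (rewire G τ) bond hatEnd v ⟩
  concatMap (labelIfAt (rewire G τ) bond hatEnd v) (allEnds G)
    ≡⟨ concatMap-cong moved (allEnds G) ⟩
  concatMap (labelIfAt G bond hatEnd v ∘ τ) (allEnds G)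
    ≡⟨ concatMap-map _ τ (allEnds G) ⟨
  concatMap (labelIfAt G bond hatEnd v) (map τ (allEnds G))
    ↭⟨ concatMap⁺ _ (map-involutive-↭ (allEnds-unique G) (∈-allEnds G) τ τ∘τ≡id) ⟩
  concatMap (labelIfAt G bond hatEnd v) (allEnds G)
    ≡⟨ labelsAt-allEnds G bond hatEnd v ⟨
  labelsAt G bond hatEnd v
    ∎
  where
  open PermutationReasoning
  at : End G → Label → List Label
  at x l = if does (endpointOf G x ≟ᶠ v) then [ l ] else []
  moved : ∀ x → labelIfAt (rewire G τ) bond hatEnd v x ≡ labelIfAt G bond hatEnd v (τ x)
  moved (e , false) = cong (at (τ (e , false))) (sym (τ-label (e , false)))
  moved (e , true)  = cong (at (τ (e , true)))  (sym (τ-label (e , true)))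

label : ∀ {P G} → Realization P G → End G → Label
label {G = G} ρ = uncurry (endLabel G (bond ρ) (hatEnd ρ))

rewire-realization : ∀ {P G} (ρ : Realization P G) (τ : End G → End G) → Involutive _≡_ τ →
                     (∀ x → label ρ (τ x) ≡ label ρ x) → Realization P (rewire G τ)
rewire-realization {G = G} ρ τ τ∘τ≡id τ-label = record
  { tile   = tile ρ
  ; tileIn = tileIn ρ
  ; bond   = bond ρ
  ; hatEnd = hatEnd ρ
  ; match  = λ v → ↭-trans (labelsAt-rewire G τ (bond ρ) (hatEnd ρ) τ∘τ≡id τ-label v) (match ρ v)
  }

swapEnds : (G : Graph) → End G → End G → Graph
swapEnds G a b = rewire G (transpose (≟-End G) a b)

swapEnds-realization : ∀ {P G} (ρ : Realization P G) {a b} → label ρ a ≡ label ρ b →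
                       Realization P (swapEnds G a b)
swapEnds-realization {G = G} ρ {a} {b} a∼b = rewire-realization ρ (transpose (≟-End G) a b)
  (transpose-involutive (≟-End G) a b) (transpose-preserves (≟-End G) (label ρ) a∼b)

swapEnds-≅ : ∀ {P G} → CminIs P G → (ρ : Realization P G) → ∀ {a b} → label ρ a ≡ label ρ b →
             swapEnds G a b ≅ G
swapEnds-≅ ((0<order , _ , minimal) , unique) ρ a∼b =
  unique _ (0<order , swapEnds-realization ρ a∼b , minimal)

ends-swapEnds-untouched : ∀ G {a b : End G} e → e ≢ proj₁ a → e ≢ proj₁ b →
                          ends (swapEnds G a b) e ≡ ends G e
ends-swapEnds-untouched G {a} {b} e e≢a e≢b = cong₂ _,_ (untouched false) (untouched true)
  where
  untouched : ∀ β → endpointOf G (transpose (≟-End G) a b (e , β)) ≡ endpoint G e β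
  untouched β = cong (endpointOf G) (transpose-fixed (≟-End G) (e≢a ∘ cong proj₁) (e≢b ∘ cong proj₁))

end-with-label : ∀ {P G} (ρ : Realization P G) e f → bond ρ e ≡ bond ρ f →
                 ∃ λ β → label ρ (e , true) ≡ label ρ (f , β)
end-with-label ρ e f same with hatEnd ρ e | hatEnd ρ f
... | false | false = true  , cong₂ lab same refl
... | false | true  = false , cong₂ lab same refl
... | true  | false = false , cong₂ lab same refl
... | true  | true  = true  , cong₂ lab same refl

Simple : Graph → Set
Simple G = ∀ e f → SameEnds (ends G e) (ends G f) → e ≡ f

module _ {A : Set} where

  SameEnds-sym : {p q : A × A} → SameEnds p q → SameEnds q p
  SameEnds-sym (inj₁ (x , y)) = inj₁ (sym x , sym y)
  SameEnds-sym (inj₂ (x , y)) = inj₂ (sym y , sym x)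

  SameEnds-trans : {p q r : A × A} → SameEnds p q → SameEnds q r → SameEnds p r
  SameEnds-trans (inj₁ (x , y)) (inj₁ (u , v)) = inj₁ (trans x u , trans y v)
  SameEnds-trans (inj₁ (x , y)) (inj₂ (u , v)) = inj₂ (trans x u , trans y v)
  SameEnds-trans (inj₂ (x , y)) (inj₁ (u , v)) = inj₂ (trans x v , trans y u)
  SameEnds-trans (inj₂ (x , y)) (inj₂ (u , v)) = inj₁ (trans x v , trans y u)

  SameEnds-map : ∀ {B : Set} (g : A → B) {p q : A × A} → SameEnds p q →
                 SameEnds (g (proj₁ p) , g (proj₂ p)) (g (proj₁ q) , g (proj₂ q))
  SameEnds-map g (inj₁ (x , y)) = inj₁ (cong g x , cong g y)
  SameEnds-map g (inj₂ (x , y)) = inj₂ (cong g x , cong g y)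

≅-simple : ∀ {G H} → H ≅ G → Simple G → Simple H
≅-simple iso simple e f parallel = Injection.injective (Inverse⇒Injection emap)
  (simple _ _ (SameEnds-trans (pres e)
              (SameEnds-trans (SameEnds-map (Inverse.to vmap) parallel) (SameEnds-sym (pres f)))))
  where open _≅_ iso

↑ˡ≢↑ʳ : ∀ {m n} (i : Fin m) (j : Fin n) → i ↑ˡ n ≢ m ↑ʳ j
↑ˡ≢↑ʳ {m} {n} i j eq with trans (sym (splitAt-↑ˡ m i n)) (trans (cong (splitAt m) eq) (splitAt-↑ʳ m n j))
... | ()

ends-cycleEdge : ∀ k (i : Fin k) → ends (Wheel k) (i ↑ˡ k) ≡ (suc i , suc (next i))
ends-cycleEdge k i rewrite splitAt-↑ˡ k i k = refl

ends-spoke : ∀ k (j : Fin k) → ends (Wheel k) (k ↑ʳ j) ≡ (zero , suc j)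
ends-spoke k j rewrite splitAt-↑ʳ k k j = refl

next-view : ∀ {j} (i : Fin (ℕ.suc j)) →
            (toℕ i < j × toℕ (next i) ≡ ℕ.suc (toℕ i)) ⊎ (j ℕ.≤ toℕ i × next i ≡ zero)
next-view {j} i with toℕ i ℕ.<? j
... | yes i<j = inj₁ (i<j , toℕ-fromℕ< (ℕ.s≤s i<j))
... | no i≮j  = inj₂ (≮⇒≥ i≮j , refl)

next-next≢ : ∀ {k} → 3 ℕ.≤ k → (i : Fin k) → next (next i) ≢ i
next-next≢ {ℕ.suc j} (ℕ.s≤s 1<j) i eq with next-view i | next-view (next i)
... | inj₁ (_ , i+1) | inj₁ (_ , i+2) =
  <⇒≢ (ℕ.s≤s (n≤1+n _)) (trans (sym (cong toℕ eq)) (trans i+2 (cong ℕ.suc i+1)))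
... | inj₁ (_ , i+1) | inj₂ (j≤i+1 , i+2↦0) =
  ≤⇒≯ (subst (j ℕ.≤_) (trans i+1 (cong (ℕ.suc ∘ toℕ) (trans (sym eq) i+2↦0))) j≤i+1) 1<j
... | inj₂ (j≤i , i+1↦0) | inj₁ (_ , i+2) =
  ≤⇒≯ (subst (j ℕ.≤_) (trans (sym (cong toℕ eq)) (trans i+2 (cong (ℕ.suc ∘ toℕ) i+1↦0))) j≤i) 1<j
... | inj₂ (_ , i+1↦0) | inj₂ (j≤i+1 , _) =
  ≤⇒≯ (m≤n⇒m≤1+n (subst (j ℕ.≤_) (cong toℕ i+1↦0) j≤i+1)) 1<j

data WheelEdge (k : ℕ) : Edge (Wheel k) → Set where
  isCycleEdge : (i : Fin k) → WheelEdge k (i ↑ˡ k)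
  isSpoke     : (j : Fin k) → WheelEdge k (k ↑ʳ j)

wheelEdge : ∀ k (e : Edge (Wheel k)) → WheelEdge k e
wheelEdge k e with splitAt k e in eq
... | inj₁ i = subst (WheelEdge k) (splitAt⁻¹-↑ˡ eq) (isCycleEdge i)
... | inj₂ j = subst (WheelEdge k) (splitAt⁻¹-↑ʳ eq) (isSpoke j)

Wheel-simple : ∀ {k} → 3 ℕ.≤ k → Simple (Wheel k)
Wheel-simple {k} 3≤k e f parallel with wheelEdge k e | wheelEdge k f
... | isCycleEdge i | isCycleEdge i′
  with subst₂ SameEnds (ends-cycleEdge k i) (ends-cycleEdge k i′) parallel
...   | inj₁ (i≡i′ , _) = cong (_↑ˡ k) (suc-injective i≡i′)
...   | inj₂ (i≡i′+1 , i+1≡i′) =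
  ⊥-elim (next-next≢ 3≤k i′ (trans (cong next (sym (suc-injective i≡i′+1))) (suc-injective i+1≡i′)))
Wheel-simple {k} 3≤k e f parallel | isCycleEdge i | isSpoke j
  with subst₂ SameEnds (ends-cycleEdge k i) (ends-spoke k j) parallel
...   | inj₁ (() , _)
...   | inj₂ (_ , ())
Wheel-simple {k} 3≤k e f parallel | isSpoke j | isCycleEdge i
  with subst₂ SameEnds (ends-spoke k j) (ends-cycleEdge k i) parallel
...   | inj₁ (() , _)
...   | inj₂ (() , _)
Wheel-simple {k} 3≤k e f parallel | isSpoke j | isSpoke j′
  with subst₂ SameEnds (ends-spoke k j) (ends-spoke k j′) parallel
...   | inj₁ (_ , j≡j′) = cong (k ↑ʳ_) (suc-injective j≡j′)
...   | inj₂ (() , _)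

swapEnds-Wheel-not-simple : ∀ {k} (i j : Fin k) → j ≢ i → j ≢ next i → ∀ β →
                            ¬ Simple (swapEnds (Wheel k) (i ↑ˡ k , true) (k ↑ʳ j , β))
swapEnds-Wheel-not-simple {k} i j j≢i j≢i+1 true simple =
  j≢i+1 (↑ʳ-injective k j (next i)
    (simple (k ↑ʳ j) (k ↑ʳ next i) (subst₂ SameEnds (sym ends-s) (sym ends-t) (inj₁ (refl , refl)))))
  where
  c s : End (Wheel k)
  c = i ↑ˡ k , true
  s = k ↑ʳ j , true
  ends-s : ends (swapEnds (Wheel k) c s) (k ↑ʳ j) ≡ (zero , suc (next i))
  ends-s = cong₂ _,_
    (trans (cong (endpointOf (Wheel k))
                 (transpose-fixed (≟-End (Wheel k)) (↑ˡ≢↑ʳ i j ∘ sym ∘ cong proj₁) (λ ())))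
           (cong proj₁ (ends-spoke k j)))
    (trans (cong (endpointOf (Wheel k)) (transpose-right (≟-End (Wheel k)) c s))
           (cong proj₂ (ends-cycleEdge k i)))
  ends-t : ends (swapEnds (Wheel k) c s) (k ↑ʳ next i) ≡ (zero , suc (next i))
  ends-t = trans (ends-swapEnds-untouched (Wheel k) (k ↑ʳ next i)
                   (↑ˡ≢↑ʳ i (next i) ∘ sym) (j≢i+1 ∘ sym ∘ ↑ʳ-injective k _ _))
                 (ends-spoke k (next i))
swapEnds-Wheel-not-simple {k} i j j≢i j≢i+1 false simple =
  ↑ˡ≢↑ʳ i i (simple (i ↑ˡ k) (k ↑ʳ i) (subst₂ SameEnds (sym ends-c) (sym ends-t) (inj₂ (refl , refl))))
  where
  c s : End (Wheel k)
  c = i ↑ˡ k , true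
  s = k ↑ʳ j , false
  ends-c : ends (swapEnds (Wheel k) c s) (i ↑ˡ k) ≡ (suc i , zero)
  ends-c = cong₂ _,_
    (trans (cong (endpointOf (Wheel k))
                 (transpose-fixed (≟-End (Wheel k)) (λ ()) (↑ˡ≢↑ʳ i j ∘ cong proj₁)))
           (cong proj₁ (ends-cycleEdge k i)))
    (trans (cong (endpointOf (Wheel k)) (transpose-left (≟-End (Wheel k)) c s))
           (cong proj₁ (ends-spoke k j)))
  ends-t : ends (swapEnds (Wheel k) c s) (k ↑ʳ i) ≡ (zero , suc i)
  ends-t = trans (ends-swapEnds-untouched (Wheel k) (k ↑ʳ i)
                   (↑ˡ≢↑ʳ i i ∘ sym) (j≢i ∘ sym ∘ ↑ʳ-injective k _ _))
                 (ends-spoke k i)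

non-incident-spoke : ∀ k (i j : Fin k) → ¬ Incident (Wheel k) (i ↑ˡ k) (k ↑ʳ j) → j ≢ i × j ≢ next i
non-incident-spoke k i j not-incident =
    (λ { refl → not-incident (false , true ,
                  trans (cong proj₁ (ends-cycleEdge k i)) (sym (cong proj₂ (ends-spoke k i)))) })
  , (λ { refl → not-incident (true , true ,
                  trans (cong proj₂ (ends-cycleEdge k i)) (sym (cong proj₂ (ends-spoke k (next i))))) })

Wheel-distant-bonds-differ : ∀ {k P} → 3 ℕ.≤ k → CminIs P (Wheel k) → (ρ : Realization P (Wheel k)) →
                             (i j : Fin k) → j ≢ i → j ≢ next i → bond ρ (i ↑ˡ k) ≢ bond ρ (k ↑ʳ j)
Wheel-distant-bonds-differ {k} 3≤k cmin ρ i j j≢i j≢i+1 same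
  with β , c∼s ← end-with-label ρ (i ↑ˡ k) (k ↑ʳ j) same =
  swapEnds-Wheel-not-simple i j j≢i j≢i+1 β (≅-simple (swapEnds-≅ cmin ρ c∼s) (Wheel-simple 3≤k))

lemma2 : (n : ℕ) → 4 < n → (P : Pot) → CminIs P (W n)
       → (ρ : Realization P (W n)) → (i j : Fin (pred n))
       → ¬ Incident (W n) (cycleEdge n i) (spoke n j)
       → bond ρ (cycleEdge n i) ≢ bond ρ (spoke n j)
lemma2 (ℕ.suc k) (ℕ.s≤s 3<k) P cmin ρ i j not-incident
  with j≢i , j≢i+1 ← non-incident-spoke k i j not-incident =
  Wheel-distant-bonds-differ (<⇒≤ 3<k) cmin ρ i j j≢i j≢i+1
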